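{- Let $X$ be a finite set of $m+1$ alternatives, $N=\{1,\dots,n\}$ with $n\ge 3$, and let $g:NP(n,m+1)\to X$ be strategy-proof. Let $j\in N$, $r\in NP(n,m+1)$ and $a,b\in X$ with $a\succ_{r(j)}b$, and let $Y=\{y\in X: a\succ_{r(j)}y\succ_{r(j)}b\}$. (1) If $g(r)\notin Y$ and there is no $u\in NP(n,m+1)$ with $g(u)=g(r)$, $u$ obtained from $r$ by moving $b$ up in $r(j)$ but not above $a$, and $\sigma_j(u,a,b)<\sigma_j(r,a,b)$, then $b\succ_{r(i)}y$ for all $y\in Y$ and all $i\in N\setminus\{j\}$. (2) If $g(r)\notin Y\cup\{a\}$ and there is no $u\in NP(n,m+1)$ with $g(u)=g(r)$, $u$ obtained from $r$ by moving $a$ down in $r(j)$ but not below $b$, and $\sigma_j(u,a,b)<\sigma_j(r,a,b)$, then $y\succ_{r(i)}a$ for all $y\in Y$ and all $i\in N\setminus\{j\}$.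
   Context: $NP(n,m+1)$ denotes the set of profiles $p:N\to L(X)$ ($L(X)$ = strict linear orderings of $X$) such that for every pair of distinct $c,d\in X$ there are $i,i'\in N$ with $c\succ_{p(i)}d$ and $d\succ_{p(i')}c$. Two profiles are $h$-variants if they agree except possibly at individual $h$; $g$ is strategy-proof if there are no $h$-variants $p,p'\in NP(n,m+1)$ with $g(p')\succ_{p(h)}g(p)$. The position of $c$ in an ordering $\succ$ is $1+|\{c'\in X:c'\succ c\}|$; $c$ ranks above $d$ if it has a lower position number. $\sigma_i(r,a,b)$ is the number of alternatives strictly between $a$ and $b$ in $r(i)$. Given $a\succ_{r(j)}b$, a profile $s$ is obtained from $r$ by moving $b$ up in $r(j)$ but not above $a$ (resp. moving $a$ down in $r(j)$ but not below $b$) if $b$ ranks higher (resp. $a$ ranks lower) in $s(j)$ than in $r(j)$, $s(i)=r(i)$ for all $i\neq j$, and $a$ ranks above $b$ in $s(j)$. -}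

module Defs where

open import Data.Nat using (ℕ; suc)
open import Data.Fin using (Fin; toℕ; _<?_) renaming (_<_ to _<ᶠ_)
open import Data.Fin.Properties using (_≟_)
open import Data.List using (List; length; filter)
open import Data.List using () renaming (allFin to allFinL)
open import Data.Product using (_×_; ∃-syntax; _,_)
open import Data.Sum using (_⊎_)
open import Relation.Nullary using (¬_)
open import Relation.Nullary.Decidable using (_×-dec_; _⊎-dec_)
open import Relation.Binary.PropositionalEquality using (_≡_; _≢_)
open import Function.Definitions using (Injective)

-- A strict linear ordering of X = Fin k, represented by its ranking:
-- pos c is (position of c) - 1, an injective (hence bijective) map X → Fin k.
record Ord (k : ℕ) : Set where
  field
    pos     : Fin k → Fin k
    pos-inj : Injective _≡_ _≡_ pos
open Ord public

_≻⟨_⟩_ : {k : ℕ} → Fin k → Ord k → Fin k → Set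
c ≻⟨ o ⟩ d = pos o c <ᶠ pos o d

-- position of c: 1 + |{c' : c' ≻ c}|  (= 1 + pos c, as pos is a bijection)
position : {k : ℕ} → Ord k → Fin k → ℕ
position o c = suc (toℕ (pos o c))

SameOrd : {k : ℕ} → Ord k → Ord k → Set
SameOrd o o' = ∀ c → pos o c ≡ pos o' c

Profile : ℕ → ℕ → Set
Profile n k = Fin n → Ord k

NP : {n k : ℕ} → Profile n k → Set
NP {n} {k} p = ∀ (c d : Fin k) → c ≢ d →
  (∃[ i ] (c ≻⟨ p i ⟩ d)) × (∃[ i' ] (d ≻⟨ p i' ⟩ c))

Variant : {n k : ℕ} → Fin n → Profile n k → Profile n k → Set
Variant h p p' = ∀ i → i ≢ h → SameOrd (p i) (p' i)

StrategyProof : {n k : ℕ} → (Profile n k → Fin k) → Set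
StrategyProof {n} {k} g = ∀ (h : Fin n) (p p' : Profile n k) →
  NP p → NP p' → Variant h p p' → ¬ (g p' ≻⟨ p h ⟩ g p)

Between : {k : ℕ} → Ord k → Fin k → Fin k → Fin k → Set
Between o a b c = ((a ≻⟨ o ⟩ c) × (c ≻⟨ o ⟩ b)) ⊎ ((b ≻⟨ o ⟩ c) × (c ≻⟨ o ⟩ a))

between? : {k : ℕ} (o : Ord k) (a b c : Fin k) → Relation.Nullary.Dec (Between o a b c)
between? o a b c =
  ((pos o a <? pos o c) ×-dec (pos o c <? pos o b)) ⊎-dec
  ((pos o b <? pos o c) ×-dec (pos o c <? pos o a))

σ : {n k : ℕ} → Fin n → Profile n k → Fin k → Fin k → ℕ
σ {k = k} i r a b = length (filter (between? (r i) a b) (allFinL k))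

MovedUp : {n k : ℕ} → Fin n → Fin k → Fin k → Profile n k → Profile n k → Set
MovedUp j a b r s =
  (position (s j) b Data.Nat.< position (r j) b) × Variant j r s × (a ≻⟨ s j ⟩ b)

MovedDown : {n k : ℕ} → Fin n → Fin k → Fin k → Profile n k → Profile n k → Set
MovedDown j a b r s =
  (position (r j) a Data.Nat.< position (s j) a) × Variant j r s × (a ≻⟨ s j ⟩ b)

module Submission where

-- Suppose some voter i ≠ j ranks some y ∈ Y above b.
-- Choose such a y as close to b in r(j) as possible, and sink it in r(j) to just
-- below b.  The new profile u moves b up without moving it above a.  The only
-- pairs reversed in r(j) are (y, d) with d between y and b or d = b; voter i
-- still ranks y ≻ b, and b above every such d (otherwise d would be a witness
-- closer to b), so u ∈ NP.  By strategy-proofness a changed outcome would be the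
-- upper member of a reversed pair, i.e. y ∈ Y, hence g(u) = g(r).  Finally y
-- leaves the interval between a and b while nothing enters it, so σ_j drops:
-- u is exactly what the hypothesis forbids.  Part (2) is dual: raise the y ∈ Y
-- closest to a that some i ≠ j ranks below a to just above a.

open import Defs
open import Data.Nat using (ℕ; suc; pred; _≤_; _<_; _∸_; z≤n; s≤s; >-nonZero)
open import Data.Nat.Properties
open import Data.Fin using (Fin; toℕ; fromℕ<)
open import Data.Fin.Properties using (toℕ-injective; toℕ<n; toℕ-fromℕ<; any?)
  renaming (_≟_ to _≟ᶠ_; _<?_ to _<ᶠ?_)
open import Data.List using (_∷_; length; filter; allFin)
open import Data.List.Membership.Propositional using (_∈_)
open import Data.List.Membership.Propositional.Properties using (∈-allFin)
open import Data.List.Relation.Unary.Any using (here; there)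
open import Data.List.Relation.Binary.Sublist.Propositional using (⊆-refl)
open import Data.List.Relation.Binary.Sublist.Propositional.Properties
  using (filter⁺; length-mono-≤)
open import Data.Product using (_×_; _,_; ∃-syntax; proj₁; proj₂)
open import Data.Sum using (inj₁; inj₂)
open import Data.Empty using (⊥; ⊥-elim)
open import Function using (_∘_; _on_)
open import Function.Definitions using (Injective)
open import Induction.WellFounded using (Acc; acc)
open import Data.Nat.Induction using (<-wellFounded)
open import Relation.Binary.Construct.On using (wellFounded)
open import Relation.Nullary using (¬_; Dec; yes; no; ¬?)
open import Relation.Nullary.Decidable using (_×-dec_)
open import Relation.Binary.PropositionalEquality
  using (_≡_; _≢_; refl; sym; trans; cong; subst; subst₂; module ≡-Reasoning)

private
  variable
    n k : ℕ

demote : ℕ → ℕ → ℕ → ℕ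
demote lo hi t with t ≟ lo
... | yes _ = hi
... | no _ with (lo <? t) ×-dec (t ≤? hi)
...   | yes _ = pred t
...   | no _ = t

promote : ℕ → ℕ → ℕ → ℕ
promote lo hi t with t ≟ hi
... | yes _ = lo
... | no _ with (lo ≤? t) ×-dec (t <? hi)
...   | yes _ = suc t
...   | no _ = t

data DemoteView (lo hi t : ℕ) : ℕ → Set where
  at-lo    : t ≡ lo → DemoteView lo hi t hi
  in-range : lo < t → t ≤ hi → DemoteView lo hi t (pred t)
  outside  : t ≢ lo → ¬ (lo < t × t ≤ hi) → DemoteView lo hi t t

demote-view : ∀ lo hi t → DemoteView lo hi t (demote lo hi t)
demote-view lo hi t with t ≟ lo
... | yes t≡lo = at-lo t≡lo
... | no t≢lo with (lo <? t) ×-dec (t ≤? hi)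
...   | yes (lo<t , t≤hi) = in-range lo<t t≤hi
...   | no ∉range = outside t≢lo ∉range

data PromoteView (lo hi t : ℕ) : ℕ → Set where
  at-hi    : t ≡ hi → PromoteView lo hi t lo
  in-range : lo ≤ t → t < hi → PromoteView lo hi t (suc t)
  outside  : t ≢ hi → ¬ (lo ≤ t × t < hi) → PromoteView lo hi t t

promote-view : ∀ lo hi t → PromoteView lo hi t (promote lo hi t)
promote-view lo hi t with t ≟ hi
... | yes t≡hi = at-hi t≡hi
... | no t≢hi with (lo ≤? t) ×-dec (t <? hi)
...   | yes (lo≤t , t<hi) = in-range lo≤t t<hi
...   | no ∉range = outside t≢hi ∉range

-- Anything above some s is positive, so its predecessor is smaller.
pred-< : ∀ {s t} → s < t → pred t < t
pred-< {t = suc t} _ = ≤-refl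

demote-lo : ∀ lo hi → demote lo hi lo ≡ hi
demote-lo lo hi with demote lo hi lo | demote-view lo hi lo
... | _ | at-lo _ = refl
... | _ | in-range lo<lo _ = ⊥-elim (<-irrefl refl lo<lo)
... | _ | outside lo≢lo _ = ⊥-elim (lo≢lo refl)

demote-in : ∀ {lo hi t} → lo < t → t ≤ hi → demote lo hi t ≡ pred t
demote-in {lo} {hi} {t} lo<t t≤hi with demote lo hi t | demote-view lo hi t
... | _ | at-lo t≡lo = ⊥-elim (<-irrefl (sym t≡lo) lo<t)
... | _ | in-range _ _ = refl
... | _ | outside _ ∉range = ⊥-elim (∉range (lo<t , t≤hi))

promote-hi : ∀ lo hi → promote lo hi hi ≡ lo
promote-hi lo hi with promote lo hi hi | promote-view lo hi hi
... | _ | at-hi _ = refl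
... | _ | in-range _ hi<hi = ⊥-elim (<-irrefl refl hi<hi)
... | _ | outside hi≢hi _ = ⊥-elim (hi≢hi refl)

promote-in : ∀ {lo hi t} → lo ≤ t → t < hi → promote lo hi t ≡ suc t
promote-in {lo} {hi} {t} lo≤t t<hi with promote lo hi t | promote-view lo hi t
... | _ | at-hi t≡hi = ⊥-elim (<-irrefl t≡hi t<hi)
... | _ | in-range _ _ = refl
... | _ | outside _ ∉range = ⊥-elim (∉range (lo≤t , t<hi))

promote-demote : ∀ {lo hi} → lo < hi → ∀ t → promote lo hi (demote lo hi t) ≡ t
promote-demote {lo} {hi} lo<hi t with demote lo hi t | demote-view lo hi t
... | _ | at-lo refl = promote-hi lo hi
... | _ | in-range lo<t t≤hi =
  trans (promote-in (<⇒≤pred lo<t) (<-≤-trans (pred-< lo<t) t≤hi)) (suc-pred t {{t≢0}})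
  where t≢0 = >-nonZero (≤-<-trans z≤n lo<t)
... | _ | outside t≢lo ∉range with promote lo hi t | promote-view lo hi t
...   | _ | at-hi refl = ⊥-elim (∉range (lo<hi , ≤-refl))
...   | _ | in-range lo≤t t<hi = ⊥-elim (∉range (≤∧≢⇒< lo≤t (t≢lo ∘ sym) , <⇒≤ t<hi))
...   | _ | outside _ _ = refl

demote-promote : ∀ {lo hi} → lo < hi → ∀ t → demote lo hi (promote lo hi t) ≡ t
demote-promote {lo} {hi} lo<hi t with promote lo hi t | promote-view lo hi t
... | _ | at-hi refl = demote-lo lo hi
... | _ | in-range lo≤t t<hi = demote-in (s≤s lo≤t) t<hi
... | _ | outside t≢hi ∉range with demote lo hi t | demote-view lo hi t
...   | _ | at-lo refl = ⊥-elim (∉range (≤-refl , lo<hi))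
...   | _ | in-range lo<t t≤hi = ⊥-elim (∉range (<⇒≤ lo<t , ≤∧≢⇒< t≤hi t≢hi))
...   | _ | outside _ _ = refl

demote-reversal : ∀ {lo hi s t} → lo < hi → s < t → demote lo hi t < demote lo hi s →
                  s ≡ lo × t ≤ hi
demote-reversal {lo} {hi} {s} {t} lo<hi s<t rev = go (demote-view lo hi s) (demote-view lo hi t) rev
  where
  go : ∀ {vs vt} → DemoteView lo hi s vs → DemoteView lo hi t vt → vt < vs → s ≡ lo × t ≤ hi
  go (at-lo s≡lo) (at-lo t≡lo) _ = ⊥-elim (<-irrefl (trans s≡lo (sym t≡lo)) s<t)
  go (at-lo s≡lo) (in-range _ t≤hi) _ = s≡lo , t≤hi
  go (at-lo s≡lo) (outside _ _) t<hi = s≡lo , <⇒≤ t<hi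
  go (in-range lo<s _) (at-lo refl) _ = ⊥-elim (<-asym lo<s s<t)
  go (in-range lo<s _) (in-range _ _) rev' = ⊥-elim (<-asym rev' (pred-mono-< {{>-nonZero (≤-<-trans z≤n lo<s)}} s<t))
  go (in-range lo<s _) (outside _ _) t<ps = ⊥-elim (<-asym s<t (<-trans t<ps (pred-< lo<s)))
  go (outside _ _) (at-lo refl) hi<s = ⊥-elim (<-asym s<t (<-trans lo<hi hi<s))
  go (outside _ _) (in-range _ _) pt<s = ⊥-elim (<⇒≱ pt<s (<⇒≤pred s<t))
  go (outside _ _) (outside _ _) t<s = ⊥-elim (<-asym s<t t<s)

promote-reversal : ∀ {lo hi s t} → lo < hi → s < t → promote lo hi t < promote lo hi s →
                   t ≡ hi × lo ≤ s
promote-reversal {lo} {hi} {s} {t} lo<hi s<t rev = go (promote-view lo hi s) (promote-view lo hi t) rev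
  where
  go : ∀ {vs vt} → PromoteView lo hi s vs → PromoteView lo hi t vt → vt < vs → t ≡ hi × lo ≤ s
  go (at-hi s≡hi) (at-hi t≡hi) _ = ⊥-elim (<-irrefl (trans s≡hi (sym t≡hi)) s<t)
  go (at-hi refl) (in-range _ t<hi) _ = ⊥-elim (<-asym s<t t<hi)
  go (at-hi refl) (outside _ _) t<lo = ⊥-elim (<-asym t<lo (<-trans lo<hi s<t))
  go (in-range lo≤s _) (at-hi t≡hi) _ = t≡hi , lo≤s
  go (in-range _ _) (in-range _ _) rev' = ⊥-elim (<-asym rev' (s≤s s<t))
  go (in-range _ _) (outside _ _) (s≤s t≤s) = ⊥-elim (<⇒≱ s<t t≤s)
  go (outside _ _) (at-hi t≡hi) lo<s = t≡hi , <⇒≤ lo<s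
  go (outside _ _) (in-range _ _) st<s = ⊥-elim (<-asym s<t (<-trans (n<1+n _) st<s))
  go (outside _ _) (outside _ _) t<s = ⊥-elim (<-asym s<t t<s)

demote-bounded : ∀ {lo hi t} → hi < k → t < k → demote lo hi t < k
demote-bounded {lo = lo} {hi} {t} hi<k t<k with demote lo hi t | demote-view lo hi t
... | _ | at-lo _ = hi<k
... | _ | in-range lo<t _ = <-trans (pred-< lo<t) t<k
... | _ | outside _ _ = t<k

promote-bounded : ∀ {lo hi t} → lo < hi → hi < k → t < k → promote lo hi t < k
promote-bounded {lo = lo} {hi} {t} lo<hi hi<k t<k with promote lo hi t | promote-view lo hi t
... | _ | at-hi _ = <-trans lo<hi hi<k
... | _ | in-range _ t<hi = ≤-trans (s≤s t<hi) hi<k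
... | _ | outside _ _ = t<k

rank : Ord k → Fin k → ℕ
rank o c = toℕ (pos o c)

rank-injective : ∀ (o : Ord k) {c d} → rank o c ≡ rank o d → c ≡ d
rank-injective o e = pos-inj o (toℕ-injective e)

prefers? : ∀ (o : Ord k) c d → Dec (c ≻⟨ o ⟩ d)
prefers? o c d = pos o c <ᶠ? pos o d

≻⇒≢ : ∀ (o : Ord k) {c d} → c ≻⟨ o ⟩ d → c ≢ d
≻⇒≢ o c≻d refl = <-irrefl refl c≻d

≻-trans : ∀ (o : Ord k) {c d e} → c ≻⟨ o ⟩ d → d ≻⟨ o ⟩ e → c ≻⟨ o ⟩ e
≻-trans o = <-trans

≻-connex : ∀ (o : Ord k) {c d} → c ≢ d → ¬ (c ≻⟨ o ⟩ d) → d ≻⟨ o ⟩ c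
≻-connex o c≢d c⊁d = ≤∧≢⇒< (≮⇒≥ c⊁d) (c≢d ∘ rank-injective o ∘ sym)

unflipped : ∀ (o o′ : Ord k) {c d} → c ≻⟨ o ⟩ d → ¬ (d ≻⟨ o′ ⟩ c) → c ≻⟨ o′ ⟩ d
unflipped o o′ c≻d = ≻-connex o′ (λ d≡c → ≻⇒≢ o c≻d (sym d≡c))

between-shrinks : ∀ (o o′ : Ord k) {a b} → a ≻⟨ o′ ⟩ b →
                  (∀ {c} → a ≻⟨ o′ ⟩ c → a ≻⟨ o ⟩ c) → (∀ {c} → c ≻⟨ o′ ⟩ b → c ≻⟨ o ⟩ b) →
                  ∀ {c} → Between o′ a b c → Between o a b c
between-shrinks _ _ _ below-a above-b (inj₁ (a≻c , c≻b)) = inj₁ (below-a a≻c , above-b c≻b)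
between-shrinks _ o′ a≻b _ _ (inj₂ (b≻c , c≻a)) = ⊥-elim (<-asym a≻b (≻-trans o′ b≻c c≻a))

reorder : (o : Ord k) (f f⁻¹ : ℕ → ℕ) →
          (∀ {t} → t < k → f t < k) → (∀ t → f⁻¹ (f t) ≡ t) → Ord k
reorder {k} o f f⁻¹ bounded inverse = record { pos = pos′ ; pos-inj = injective }
  where
  pos′ : Fin k → Fin k
  pos′ c = fromℕ< (bounded (toℕ<n (pos o c)))

  rank′ : ∀ c → toℕ (pos′ c) ≡ f (rank o c)
  rank′ c = toℕ-fromℕ< _

  injective : Injective _≡_ _≡_ pos′
  injective {c} {d} e = rank-injective o (begin
    rank o c           ≡⟨ sym (inverse _) ⟩
    f⁻¹ (f (rank o c)) ≡⟨ cong f⁻¹ (trans (sym (rank′ c)) (trans (cong toℕ e) (rank′ d))) ⟩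
    f⁻¹ (f (rank o d)) ≡⟨ inverse _ ⟩
    rank o d           ∎)
    where open ≡-Reasoning

rank-reorder : ∀ (o : Ord k) (f f⁻¹ : ℕ → ℕ) (bounded : ∀ {t} → t < k → f t < k)
               (inverse : ∀ t → f⁻¹ (f t) ≡ t) c →
               rank (reorder o f f⁻¹ bounded inverse) c ≡ f (rank o c)
rank-reorder o f f⁻¹ bounded inverse c = toℕ-fromℕ< _

module Sink (o : Ord k) {x z : Fin k} (x≻z : x ≻⟨ o ⟩ z) where
  private
    lo = rank o x
    hi = rank o z

    bounded : ∀ {t} → t < k → demote lo hi t < k
    bounded = demote-bounded (toℕ<n (pos o z))

  sunk : Ord k
  sunk = reorder o (demote lo hi) (promote lo hi) bounded (promote-demote x≻z)

  private
    rank-sunk : ∀ c → rank sunk c ≡ demote lo hi (rank o c)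
    rank-sunk = rank-reorder o (demote lo hi) (promote lo hi) bounded (promote-demote x≻z)

  reversal : ∀ {c d} → c ≻⟨ o ⟩ d → d ≻⟨ sunk ⟩ c → c ≡ x × ¬ (z ≻⟨ o ⟩ d)
  reversal c≻d d≻′c
    with demote-reversal x≻z c≻d (subst₂ _<_ (rank-sunk _) (rank-sunk _) d≻′c)
  ... | c≡x , d≤z = rank-injective o c≡x , ≤⇒≯ d≤z

  private
    rank-x : rank sunk x ≡ hi
    rank-x = trans (rank-sunk x) (demote-lo lo hi)

    rank-z : rank sunk z ≡ pred hi
    rank-z = trans (rank-sunk z) (demote-in x≻z ≤-refl)

  z-above-x : z ≻⟨ sunk ⟩ x
  z-above-x = subst₂ _<_ (sym rank-z) (sym rank-x) (pred-< x≻z)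

  z-rises : position sunk z < position o z
  z-rises = s≤s (subst (_< hi) (sym rank-z) (pred-< x≻z))

module Raise (o : Ord k) {x z : Fin k} (z≻x : z ≻⟨ o ⟩ x) where
  private
    lo = rank o z
    hi = rank o x

    bounded : ∀ {t} → t < k → promote lo hi t < k
    bounded = promote-bounded z≻x (toℕ<n (pos o x))

  raised : Ord k
  raised = reorder o (promote lo hi) (demote lo hi) bounded (demote-promote z≻x)

  private
    rank-raised : ∀ c → rank raised c ≡ promote lo hi (rank o c)
    rank-raised = rank-reorder o (promote lo hi) (demote lo hi) bounded (demote-promote z≻x)

  reversal : ∀ {c d} → c ≻⟨ o ⟩ d → d ≻⟨ raised ⟩ c → d ≡ x × ¬ (c ≻⟨ o ⟩ z)
  reversal c≻d d≻′c
    with promote-reversal z≻x c≻d (subst₂ _<_ (rank-raised _) (rank-raised _) d≻′c)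
  ... | d≡x , z≤c = rank-injective o d≡x , ≤⇒≯ z≤c

  private
    rank-x : rank raised x ≡ lo
    rank-x = trans (rank-raised x) (promote-hi lo hi)

    rank-z : rank raised z ≡ suc lo
    rank-z = trans (rank-raised z) (promote-in ≤-refl z≻x)

  x-above-z : x ≻⟨ raised ⟩ z
  x-above-z = subst₂ _<_ (sym rank-x) (sym rank-z) (n<1+n lo)

  z-falls : position o z < position raised z
  z-falls = s≤s (subst (lo <_) (sym rank-z) (n<1+n lo))

update : Profile n k → Fin n → Ord k → Profile n k
update r j o i with i ≟ᶠ j
... | yes _ = o
... | no _ = r i

update-self : ∀ (r : Profile n k) j o → update r j o j ≡ o
update-self r j o with j ≟ᶠ j
... | yes _ = refl
... | no j≢j = ⊥-elim (j≢j refl)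

update-other : ∀ (r : Profile n k) j o {i} → i ≢ j → update r j o i ≡ r i
update-other r j o {i} i≢j with i ≟ᶠ j
... | yes i≡j = ⊥-elim (i≢j i≡j)
... | no _ = refl

update-variant : ∀ (r : Profile n k) j o → Variant j r (update r j o)
update-variant r j o i i≢j c = cong (λ o′ → pos o′ c) (sym (update-other r j o i≢j))

variant-sym : ∀ {h} {p p′ : Profile n k} → Variant h p p′ → Variant h p′ p
variant-sym v i i≢h c = sym (v i i≢h c)

update-NP : ∀ {r : Profile n k} {j o} → NP r →
            (∀ {c d} → c ≻⟨ r j ⟩ d → d ≻⟨ o ⟩ c → ∃[ i ] (i ≢ j × c ≻⟨ r i ⟩ d)) →
            NP (update r j o)
update-NP {r = r} {j} {o} np witness c d c≢d =
  keep (proj₁ (np c d c≢d)) , keep (proj₂ (np c d c≢d))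
  where
  at-other : ∀ {c d i} → i ≢ j → c ≻⟨ r i ⟩ d → ∃[ i′ ] (c ≻⟨ update r j o i′ ⟩ d)
  at-other {c} {d} {i} i≢j c≻d = i , subst (λ o′ → c ≻⟨ o′ ⟩ d) (sym (update-other r j o i≢j)) c≻d

  keep : ∀ {c d} → ∃[ i ] (c ≻⟨ r i ⟩ d) → ∃[ i ] (c ≻⟨ update r j o i ⟩ d)
  keep (i , c≻d) with i ≟ᶠ j
  ... | no i≢j = at-other i≢j c≻d
  keep {c} {d} (_ , c≻d) | yes refl with prefers? o c d
  ...   | yes c≻′d = j , subst (λ o′ → c ≻⟨ o′ ⟩ d) (sym (update-self r j o)) c≻′d
  ...   | no c⊁′d with witness c≻d (≻-connex o (≻⇒≢ (r j) c≻d) c⊁′d)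
  ...     | i′ , i′≢j , c≻ᵢd = at-other i′≢j c≻ᵢd

-- Strategy-proofness: if voter j switches from r(j) to o and the outcome moves,
-- then r(j) prefers the old outcome and o the new one.
outcome-kept : ∀ {g : Profile n k → Fin k} {r j o} → StrategyProof g →
               NP r → NP (update r j o) →
               (∀ {d} → g r ≻⟨ r j ⟩ d → ¬ (d ≻⟨ o ⟩ g r)) →
               g (update r j o) ≡ g r
outcome-kept {g = g} {r} {j} {o} sp npr npu unreversed with g (update r j o) ≟ᶠ g r
... | yes same = same
... | no moved = ⊥-elim (unreversed old-preferred new-preferred)
  where
  u = update r j o

  old-preferred : g r ≻⟨ r j ⟩ g u
  old-preferred = ≻-connex (r j) moved (sp j r u npr npu (update-variant r j o))

  new-preferred : g u ≻⟨ o ⟩ g r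
  new-preferred = ≻-connex o (λ e → moved (sym e)) λ gr≻gu →
    sp j u r npu npr (variant-sym {p = r} {p′ = u} (update-variant r j o))
       (subst (λ o′ → g r ≻⟨ o′ ⟩ g u) (sym (update-self r j o)) gr≻gu)

filter-strict : ∀ {A : Set} {P Q : A → Set} (P? : ∀ x → Dec (P x)) (Q? : ∀ x → Dec (Q x)) →
                (∀ {x} → P x → Q x) → ∀ {y} xs → y ∈ xs → Q y → ¬ P y →
                length (filter P? xs) < length (filter Q? xs)
filter-strict P? Q? P⇒Q (x ∷ xs) y∈ Qy ¬Py with P? x | Q? x | y∈
... | yes Px | no ¬Qx | _ = ⊥-elim (¬Qx (P⇒Q Px))
... | yes Px | yes _ | here refl = ⊥-elim (¬Py Px)
... | yes _ | yes _ | there y∈xs = s≤s (filter-strict P? Q? P⇒Q xs y∈xs Qy ¬Py)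
... | no _ | yes _ | _ = s≤s (length-mono-≤ (filter⁺ P? Q? (λ { refl → P⇒Q }) (⊆-refl {x = xs})))
... | no _ | no ¬Qx | here refl = ⊥-elim (¬Qx Qy)
... | no _ | no _ | there y∈xs = filter-strict P? Q? P⇒Q xs y∈xs Qy ¬Py

σ-decreases : ∀ j (u r : Profile n k) a b y →
              (∀ {c} → Between (u j) a b c → Between (r j) a b c) →
              Between (r j) a b y → ¬ Between (u j) a b y → σ j u a b < σ j r a b
σ-decreases {k = k} j u r a b y shrinks y-in y-out =
  filter-strict (between? (u j) a b) (between? (r j) a b) shrinks (allFin k) (∈-allFin y) y-in y-out

descend : ∀ {A : Set} (μ : A → ℕ) (Good : A → Set) (Improves : A → A → Set) →
          (∀ {y z} → Improves y z → μ z < μ y) →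
          (∀ y → Dec (∃[ z ] (Improves y z × Good z))) →
          ∀ {y} → Good y → ∃[ y* ] (Good y* × ∀ z → Improves y* z → ¬ Good z)
descend {A} μ Good Improves decreases improvable? {y} good = go good (wellFounded μ <-wellFounded y)
  where
  go : ∀ {y} → Good y → Acc (_<_ on μ) y → ∃[ y* ] (Good y* × ∀ z → Improves y* z → ¬ Good z)
  go {y} good (acc smaller) with improvable? y
  ... | no none = y , good , λ z y→z good-z → none (z , y→z , good-z)
  ... | yes (z , y→z , good-z) = go good-z (smaller (decreases y→z))

closest-above : ∀ (o : Ord k) b {Q : Fin k → Set} → (∀ y → Dec (Q y)) → ∀ {y} → Q y → y ≻⟨ o ⟩ b →
                ∃[ y* ] ((Q y* × y* ≻⟨ o ⟩ b) × ∀ z → y* ≻⟨ o ⟩ z → z ≻⟨ o ⟩ b → ¬ Q z)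
closest-above o b {Q} Q? Qy y≻b
  with descend (λ y → rank o b ∸ rank o y) (λ y → Q y × y ≻⟨ o ⟩ b)
    (λ y z → y ≻⟨ o ⟩ z × z ≻⟨ o ⟩ b)
    (λ (y≻z , z≻b) → ∸-monoʳ-< y≻z (<⇒≤ z≻b))
    (λ y → any? λ z → (prefers? o y z ×-dec prefers? o z b) ×-dec (Q? z ×-dec prefers? o z b))
    (Qy , y≻b)
... | y* , good , unimprovable = y* , good , λ z y*≻z z≻b Qz → unimprovable z (y*≻z , z≻b) (Qz , z≻b)

closest-below : ∀ (o : Ord k) a {Q : Fin k → Set} → (∀ y → Dec (Q y)) → ∀ {y} → Q y → a ≻⟨ o ⟩ y →
                ∃[ y* ] ((Q y* × a ≻⟨ o ⟩ y*) × ∀ z → a ≻⟨ o ⟩ z → z ≻⟨ o ⟩ y* → ¬ Q z)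
closest-below o a {Q} Q? Qy a≻y
  with descend (rank o) (λ y → Q y × a ≻⟨ o ⟩ y)
    (λ y z → a ≻⟨ o ⟩ z × z ≻⟨ o ⟩ y)
    (λ (_ , z≻y) → z≻y)
    (λ y → any? λ z → (prefers? o a z ×-dec prefers? o z y) ×-dec (Q? z ×-dec prefers? o a z))
    (Qy , a≻y)
... | y* , good , unimprovable = y* , good , λ z a≻z z≻y* Qz → unimprovable z (a≻z , z≻y*) (Qz , a≻z)

module Part1 {n m : ℕ} (g : Profile n (suc m) → Fin (suc m)) (sp : StrategyProof g)
  (j : Fin n) (r : Profile n (suc m)) (np-r : NP r) (a b : Fin (suc m)) (a≻b : a ≻⟨ r j ⟩ b)
  (gr∉Y : ¬ ((a ≻⟨ r j ⟩ g r) × (g r ≻⟨ r j ⟩ b)))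
  (no-move : ¬ (∃[ u ] (NP u × g u ≡ g r × MovedUp j a b r u × σ j u a b < σ j r a b))) where

  private
    o = r j

  Witness : Fin (suc m) → Set
  Witness y = a ≻⟨ o ⟩ y × ∃[ i ] (i ≢ j × y ≻⟨ r i ⟩ b)

  witness? : ∀ y → Dec (Witness y)
  witness? y = prefers? o a y ×-dec any? (λ i → ¬? (i ≟ᶠ j) ×-dec prefers? (r i) y b)

  module Sinking {y i} (a≻y : a ≻⟨ o ⟩ y) (i≢j : i ≢ j) (y≻ᵢb : y ≻⟨ r i ⟩ b)
                 (y≻b : y ≻⟨ o ⟩ b) (closest : ∀ z → y ≻⟨ o ⟩ z → z ≻⟨ o ⟩ b → ¬ Witness z) where
    open Sink o y≻b

    u : Profile n (suc m)
    u = update r j sunk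

    at-j : (F : Ord (suc m) → Set) → F sunk → F (u j)
    at-j F = subst F (sym (update-self r j sunk))

    from-j : (F : Ord (suc m) → Set) → F (u j) → F sunk
    from-j F = subst F (update-self r j sunk)

    b≻ᵢ : ∀ {d} → y ≻⟨ o ⟩ d → d ≻⟨ o ⟩ b → b ≻⟨ r i ⟩ d
    b≻ᵢ y≻d d≻b = ≻-connex (r i) (≻⇒≢ o d≻b) λ d≻ᵢb →
      closest _ y≻d d≻b (≻-trans o a≻y y≻d , i , i≢j , d≻ᵢb)

    reversals-witnessed : ∀ {c d} → c ≻⟨ o ⟩ d → d ≻⟨ sunk ⟩ c → ∃[ i′ ] (i′ ≢ j × c ≻⟨ r i′ ⟩ d)
    reversals-witnessed {d = d} c≻d d≻′c with reversal c≻d d≻′c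
    ... | refl , b⊁d with d ≟ᶠ b
    ...   | yes refl = i , i≢j , y≻ᵢb
    ...   | no d≢b = i , i≢j , ≻-trans (r i) y≻ᵢb (b≻ᵢ c≻d (≻-connex o (λ b≡d → d≢b (sym b≡d)) b⊁d))

    u-NP : NP u
    u-NP = update-NP np-r reversals-witnessed

    -- A changed outcome would be the sunk alternative y ∈ Y.
    same-outcome : g u ≡ g r
    same-outcome = outcome-kept sp np-r u-NP λ gr≻d d≻′gr →
      gr∉Y (subst (λ w → a ≻⟨ o ⟩ w × w ≻⟨ o ⟩ b) (sym (proj₁ (reversal gr≻d d≻′gr))) (a≻y , y≻b))

    a≻′b : a ≻⟨ sunk ⟩ b
    a≻′b = unflipped o sunk a≻b λ b≻′a → ≻⇒≢ o a≻y (proj₁ (reversal a≻b b≻′a))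

    interval-shrinks : ∀ {c} → Between sunk a b c → Between o a b c
    interval-shrinks = between-shrinks o sunk {a} {b} a≻′b
      (λ a≻′c → unflipped sunk o a≻′c λ c≻a →
         <-asym a≻y (subst (λ w → w ≻⟨ o ⟩ a) (proj₁ (reversal c≻a a≻′c)) c≻a))
      (λ c≻′b → unflipped sunk o c≻′b λ b≻c → ≻⇒≢ o y≻b (sym (proj₁ (reversal b≻c c≻′b))))

    y-leaves : ¬ Between sunk a b y
    y-leaves (inj₁ (_ , y≻′b)) = <-asym y≻′b z-above-x
    y-leaves (inj₂ (b≻′y , y≻′a)) = <-asym a≻′b (≻-trans sunk b≻′y y≻′a)

    moved-up : MovedUp j a b r u
    moved-up = at-j (λ w → position w b < position o b) z-rises ,
               update-variant r j sunk , at-j (λ w → a ≻⟨ w ⟩ b) a≻′b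

    σ-drops : σ j u a b < σ j r a b
    σ-drops = σ-decreases j u r a b y
      (λ {c} → interval-shrinks ∘ from-j (λ w → Between w a b c))
      (inj₁ (a≻y , y≻b)) (y-leaves ∘ from-j (λ w → Between w a b y))

    forbidden : ⊥
    forbidden = no-move (u , u-NP , same-outcome , moved-up , σ-drops)

  conclusion : ∀ i → i ≢ j → ∀ y → (a ≻⟨ o ⟩ y) × (y ≻⟨ o ⟩ b) → b ≻⟨ r i ⟩ y
  conclusion i i≢j y (a≻y , y≻b) = ≻-connex (r i) (≻⇒≢ o y≻b) λ y≻ᵢb →
    closest-witness (closest-above o b witness? (a≻y , i , i≢j , y≻ᵢb) y≻b)
    where
    closest-witness : ∃[ y* ] ((Witness y* × y* ≻⟨ o ⟩ b) × ∀ z → y* ≻⟨ o ⟩ z → z ≻⟨ o ⟩ b → ¬ Witness z) → ⊥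
    closest-witness (_ , ((a≻y* , _ , i*≢j , y*≻ᵢb) , y*≻b) , closest) =
      Sinking.forbidden a≻y* i*≢j y*≻ᵢb y*≻b closest

module Part2 {n m : ℕ} (g : Profile n (suc m) → Fin (suc m)) (sp : StrategyProof g)
  (j : Fin n) (r : Profile n (suc m)) (np-r : NP r) (a b : Fin (suc m)) (a≻b : a ≻⟨ r j ⟩ b)
  (gr∉Y : ¬ ((a ≻⟨ r j ⟩ g r) × (g r ≻⟨ r j ⟩ b))) (gr≢a : g r ≢ a)
  (no-move : ¬ (∃[ u ] (NP u × g u ≡ g r × MovedDown j a b r u × σ j u a b < σ j r a b))) where

  private
    o = r j

  Witness : Fin (suc m) → Set
  Witness y = y ≻⟨ o ⟩ b × ∃[ i ] (i ≢ j × a ≻⟨ r i ⟩ y)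

  witness? : ∀ y → Dec (Witness y)
  witness? y = prefers? o y b ×-dec any? (λ i → ¬? (i ≟ᶠ j) ×-dec prefers? (r i) a y)

  module Raising {y i} (y≻b : y ≻⟨ o ⟩ b) (i≢j : i ≢ j) (a≻ᵢy : a ≻⟨ r i ⟩ y)
                 (a≻y : a ≻⟨ o ⟩ y) (closest : ∀ z → a ≻⟨ o ⟩ z → z ≻⟨ o ⟩ y → ¬ Witness z) where
    open Raise o a≻y

    u : Profile n (suc m)
    u = update r j raised

    at-j : (F : Ord (suc m) → Set) → F raised → F (u j)
    at-j F = subst F (sym (update-self r j raised))

    from-j : (F : Ord (suc m) → Set) → F (u j) → F raised
    from-j F = subst F (update-self r j raised)

    ≻ᵢa : ∀ {c} → a ≻⟨ o ⟩ c → c ≻⟨ o ⟩ y → c ≻⟨ r i ⟩ a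
    ≻ᵢa a≻c c≻y = ≻-connex (r i) (≻⇒≢ o a≻c) λ a≻ᵢc →
      closest _ a≻c c≻y (≻-trans o c≻y y≻b , i , i≢j , a≻ᵢc)

    reversals-witnessed : ∀ {c d} → c ≻⟨ o ⟩ d → d ≻⟨ raised ⟩ c → ∃[ i′ ] (i′ ≢ j × c ≻⟨ r i′ ⟩ d)
    reversals-witnessed {c = c} c≻d d≻′c with reversal c≻d d≻′c
    ... | refl , c⊁a with c ≟ᶠ a
    ...   | yes refl = i , i≢j , a≻ᵢy
    ...   | no c≢a = i , i≢j , ≻-trans (r i) (≻ᵢa (≻-connex o c≢a c⊁a) c≻d) a≻ᵢy

    u-NP : NP u
    u-NP = update-NP np-r reversals-witnessed

    -- A changed outcome would lie above the raised y but not above a, i.e. in Y.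
    outcome-unreversed : ∀ {d} → g r ≻⟨ o ⟩ d → ¬ (d ≻⟨ raised ⟩ g r)
    outcome-unreversed gr≻d d≻′gr with reversal gr≻d d≻′gr
    ... | refl , gr⊁a = gr∉Y (≻-connex o gr≢a gr⊁a , ≻-trans o gr≻d y≻b)

    same-outcome : g u ≡ g r
    same-outcome = outcome-kept sp np-r u-NP outcome-unreversed

    a≻′b : a ≻⟨ raised ⟩ b
    a≻′b = unflipped o raised a≻b λ b≻′a → ≻⇒≢ o y≻b (sym (proj₁ (reversal a≻b b≻′a)))

    interval-shrinks : ∀ {c} → Between raised a b c → Between o a b c
    interval-shrinks = between-shrinks o raised {a} {b} a≻′b
      (λ a≻′c → unflipped raised o a≻′c λ c≻a → ≻⇒≢ o a≻y (proj₁ (reversal c≻a a≻′c)))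
      (λ c≻′b → unflipped raised o c≻′b λ b≻c →
         <-asym y≻b (subst (λ w → b ≻⟨ o ⟩ w) (proj₁ (reversal b≻c c≻′b)) b≻c))

    y-leaves : ¬ Between raised a b y
    y-leaves (inj₁ (a≻′y , _)) = <-asym a≻′y x-above-z
    y-leaves (inj₂ (b≻′y , y≻′a)) = <-asym a≻′b (≻-trans raised b≻′y y≻′a)

    moved-down : MovedDown j a b r u
    moved-down = at-j (λ w → position o a < position w a) z-falls ,
                 update-variant r j raised , at-j (λ w → a ≻⟨ w ⟩ b) a≻′b

    σ-drops : σ j u a b < σ j r a b
    σ-drops = σ-decreases j u r a b y
      (λ {c} → interval-shrinks ∘ from-j (λ w → Between w a b c))
      (inj₁ (a≻y , y≻b)) (y-leaves ∘ from-j (λ w → Between w a b y))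

    forbidden : ⊥
    forbidden = no-move (u , u-NP , same-outcome , moved-down , σ-drops)

  conclusion : ∀ i → i ≢ j → ∀ y → (a ≻⟨ o ⟩ y) × (y ≻⟨ o ⟩ b) → y ≻⟨ r i ⟩ a
  conclusion i i≢j y (a≻y , y≻b) = ≻-connex (r i) (≻⇒≢ o a≻y) λ a≻ᵢy →
    closest-witness (closest-below o a witness? (y≻b , i , i≢j , a≻ᵢy) a≻y)
    where
    closest-witness : ∃[ y* ] ((Witness y* × a ≻⟨ o ⟩ y*) × ∀ z → a ≻⟨ o ⟩ z → z ≻⟨ o ⟩ y* → ¬ Witness z) → ⊥
    closest-witness (_ , ((y*≻b , _ , i*≢j , a≻ᵢy*) , a≻y*) , closest) =
      Raising.forbidden y*≻b i*≢j a≻ᵢy* a≻y* closest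

mainTheorem9 : ∀ {n m : ℕ} → 3 ≤ n →
    (g : Profile n (suc m) → Fin (suc m)) → StrategyProof g →
    (j : Fin n) (r : Profile n (suc m)) → NP r →
    (a b : Fin (suc m)) → a ≻⟨ r j ⟩ b →
    ((¬ ((a ≻⟨ r j ⟩ g r) × (g r ≻⟨ r j ⟩ b)) →
      ¬ (∃[ u ] (NP u × g u ≡ g r × MovedUp j a b r u × σ j u a b < σ j r a b)) →
      ∀ (i : Fin n) → i ≢ j → ∀ (y : Fin (suc m)) →
        (a ≻⟨ r j ⟩ y) × (y ≻⟨ r j ⟩ b) → b ≻⟨ r i ⟩ y)
    ×
    (¬ ((a ≻⟨ r j ⟩ g r) × (g r ≻⟨ r j ⟩ b)) → g r ≢ a →
      ¬ (∃[ u ] (NP u × g u ≡ g r × MovedDown j a b r u × σ j u a b < σ j r a b)) →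
      ∀ (i : Fin n) → i ≢ j → ∀ (y : Fin (suc m)) →
        (a ≻⟨ r j ⟩ y) × (y ≻⟨ r j ⟩ b) → y ≻⟨ r i ⟩ a))
mainTheorem9 _ g sp j r np-r a b a≻b =
  (λ gr∉Y no-move → Part1.conclusion g sp j r np-r a b a≻b gr∉Y no-move) ,
  (λ gr∉Y gr≢a no-move → Part2.conclusion g sp j r np-r a b a≻b gr∉Y gr≢a no-move)
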